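{- Let $T$ be an $\mathcal{L}$-Henkin theory. The following are equivalent: (1) $T$ is prime; (2) $T$ is a meet-prime element of the lattice $\mathfrak{T}$ of all $\mathcal{L}$-Henkin theories; (3) $T$ is a meet-irreducible element of $\mathfrak{T}$.
   Context: $\mathcal{L}$ is a first-order signature and $\mathrm{Hen}(\mathcal{L})$ its Henkin expansion (obtained by iteratively adding a new constant $\mathrm{w}(\forall x\,\varphi)$, resp. $\mathrm{w}(\exists x\,\varphi)$, for each universal, resp. existential, formula). $\mathcal{L}$-Henkin sequents are pairs $\Gamma \vartriangleright \Delta$ of finite sets of $\mathrm{Hen}(\mathcal{L})$-formulas. $\mathcal{ST}^{H}$ is the calculus with Identity, Weakening, bidirectional (top-down and bottom-up) classical sequent rules for $\land,\lor,\lnot$, witness introduction/elimination rules, and bidirectional quantifier rules replacing $Qx\,\varphi$ by $\varphi[x\mapsto \mathrm{w}(Qx\,\varphi)]$ on the same side. An $\mathcal{L}$-Henkin theory is a set of $\mathcal{L}$-Henkin sequents containing all sequents provable in $\mathcal{ST}^{H}$ and closed under all its rules; $\mathfrak{T}$ is the set of all such theories ordered by inclusion (a lattice with meet given by intersection on finite sets). A theory $T$ is prime if $\Gamma \vartriangleright \Delta\in T$ with $\Gamma\cup\Delta\neq\emptyset$ implies either $\gamma \vartriangleright \emptyset \in T$ for some $\gamma \in \Gamma$ or $\emptyset \vartriangleright \delta \in T$ for some $\delta \in \Delta$. An element $a$ is meet-irreducible if $\bigwedge X = a$ for finite $X$ implies $a\in X$, and meet-prime if $\bigwedge X \le a$ for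 finite $X$ implies $x \le a$ for some $x \in X$. -}

module Defs where

open import Level using (0ℓ)
open import Data.Nat using (ℕ; zero; suc; _<ᵇ_; _≡ᵇ_; _∸_)
open import Data.Bool using (if_then_else_)
open import Data.Vec using (Vec; []; _∷_)
open import Data.List using (List; []; _∷_; [_])
open import Data.List.Relation.Unary.All using (All)
open import Data.List.Relation.Unary.Any using (Any)
open import Data.List.Membership.Propositional using (_∈_)
open import Data.List.Relation.Binary.Subset.Propositional using (_⊆_)
open import Data.Product using (Σ; _×_; ∃; proj₁)
open import Data.Sum using (_⊎_)
open import Relation.Binary.PropositionalEquality using (_≡_)
open import Relation.Nullary using (¬_)
open import Data.Unit using (⊤)

record Signature : Set₁ where
  field
    Fun      : Set
    Rel      : Set
    funArity : Fun → ℕ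
    relArity : Rel → ℕ

module Henkin (𝓛 : Signature) where
  open Signature 𝓛

  data Quant : Set where
    ∀q ∃q : Quant

  -- Hen(𝓛)-terms and Hen(𝓛)-formulas (de Bruijn indices for variables).
  -- `wit Q φ` is the Henkin witness constant w(Q x φ), where φ is the
  -- body of the quantified formula (bound variable = index 0).
  -- The mutual inductive definition yields exactly the union of the
  -- iterated expansions L ⊆ L₁ ⊆ L₂ ⊆ … , i.e. Hen(𝓛).
  data Term : Set
  data Formula : Set

  data Term where
    var : ℕ → Term
    fun : (f : Fun) → Vec Term (funArity f) → Term
    wit : Quant → Formula → Term

  data Formula where
    rel   : (R : Rel) → Vec Term (relArity R) → Formula
    _∧'_  : Formula → Formula → Formula
    _∨'_  : Formula → Formula → Formula
    ¬'_   : Formula → Formula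
    quant : Quant → Formula → Formula

  mutual
    liftT : ℕ → Term → Term
    liftT c (var i)   = if i <ᵇ c then var i else var (suc i)
    liftT c (fun f ts) = fun f (liftTs c ts)
    liftT c (wit Q φ) = wit Q φ   -- witnesses are constants

    liftTs : ∀ {n} → ℕ → Vec Term n → Vec Term n
    liftTs c []       = []
    liftTs c (t ∷ ts) = liftT c t ∷ liftTs c ts

  -- capture-avoiding substitution of s for variable k (variables above k
  -- are decremented, as the binder for k disappears)
  mutual
    substT : ℕ → Term → Term → Term
    substT k s (var i)   =
      if i <ᵇ k then var i else (if i ≡ᵇ k then s else var (i ∸ 1))
    substT k s (fun f ts) = fun f (substTs k s ts)
    substT k s (wit Q φ) = wit Q φ

    substTs : ∀ {n} → ℕ → Term → Vec Term n → Vec Term n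
    substTs k s []       = []
    substTs k s (t ∷ ts) = substT k s t ∷ substTs k s ts

  substF : ℕ → Term → Formula → Formula
  substF k s (rel R ts)  = rel R (substTs k s ts)
  substF k s (φ ∧' ψ)    = substF k s φ ∧' substF k s ψ
  substF k s (φ ∨' ψ)    = substF k s φ ∨' substF k s ψ
  substF k s (¬' φ)      = ¬' substF k s φ
  substF k s (quant Q φ) = quant Q (substF (suc k) (liftT 0 s) φ)

  _[x↦_] : Formula → Term → Formula
  φ [x↦ t ] = substF 0 t φ

  inst : Quant → Formula → Formula
  inst Q φ = φ [x↦ wit Q φ ]

  -- 𝓛-Henkin sequents Γ ▷ Δ (finite sets represented by lists; all
  -- notions below are invariant under same-membership, by Weakening)

  infix 4 _▷_
  infixl 30 _[x↦_]
  infixr 35 _∧'_ _∨'_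

  record Sequent : Set where
    constructor _▷_
    field
      ante : List Formula
      succ : List Formula

  -- Rules of ST^H : `Rule premises conclusion`
  -- ↓ = top-down rule, ↑ = bottom-up (inverted) rule

  data Rule : List Sequent → Sequent → Set where
    Id    : ∀ φ → Rule [] ([ φ ] ▷ [ φ ])
    Weak  : ∀ {Γ Γ' Δ Δ'} → Γ ⊆ Γ' → Δ ⊆ Δ' → Rule [ Γ ▷ Δ ] (Γ' ▷ Δ')
    ∧L↓   : ∀ {Γ Δ φ ψ} → Rule [ φ ∷ ψ ∷ Γ ▷ Δ ] ((φ ∧' ψ) ∷ Γ ▷ Δ)
    ∧L↑   : ∀ {Γ Δ φ ψ} → Rule [ (φ ∧' ψ) ∷ Γ ▷ Δ ] (φ ∷ ψ ∷ Γ ▷ Δ)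
    ∧R↓   : ∀ {Γ Δ φ ψ} →
            Rule ((Γ ▷ φ ∷ Δ) ∷ (Γ ▷ ψ ∷ Δ) ∷ []) (Γ ▷ (φ ∧' ψ) ∷ Δ)
    ∧R↑₁  : ∀ {Γ Δ φ ψ} → Rule [ Γ ▷ (φ ∧' ψ) ∷ Δ ] (Γ ▷ φ ∷ Δ)
    ∧R↑₂  : ∀ {Γ Δ φ ψ} → Rule [ Γ ▷ (φ ∧' ψ) ∷ Δ ] (Γ ▷ ψ ∷ Δ)
    ∨L↓   : ∀ {Γ Δ φ ψ} →
            Rule ((φ ∷ Γ ▷ Δ) ∷ (ψ ∷ Γ ▷ Δ) ∷ []) ((φ ∨' ψ) ∷ Γ ▷ Δ)
    ∨L↑₁  : ∀ {Γ Δ φ ψ} → Rule [ (φ ∨' ψ) ∷ Γ ▷ Δ ] (φ ∷ Γ ▷ Δ)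
    ∨L↑₂  : ∀ {Γ Δ φ ψ} → Rule [ (φ ∨' ψ) ∷ Γ ▷ Δ ] (ψ ∷ Γ ▷ Δ)
    ∨R↓   : ∀ {Γ Δ φ ψ} → Rule [ Γ ▷ φ ∷ ψ ∷ Δ ] (Γ ▷ (φ ∨' ψ) ∷ Δ)
    ∨R↑   : ∀ {Γ Δ φ ψ} → Rule [ Γ ▷ (φ ∨' ψ) ∷ Δ ] (Γ ▷ φ ∷ ψ ∷ Δ)
    ¬L↓   : ∀ {Γ Δ φ} → Rule [ Γ ▷ φ ∷ Δ ] ((¬' φ) ∷ Γ ▷ Δ)
    ¬L↑   : ∀ {Γ Δ φ} → Rule [ (¬' φ) ∷ Γ ▷ Δ ] (Γ ▷ φ ∷ Δ)
    ¬R↓   : ∀ {Γ Δ φ} → Rule [ φ ∷ Γ ▷ Δ ] (Γ ▷ (¬' φ) ∷ Δ)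
    ¬R↑   : ∀ {Γ Δ φ} → Rule [ Γ ▷ (¬' φ) ∷ Δ ] (φ ∷ Γ ▷ Δ)
    QL↓   : ∀ {Γ Δ Q φ} → Rule [ inst Q φ ∷ Γ ▷ Δ ] (quant Q φ ∷ Γ ▷ Δ)
    QL↑   : ∀ {Γ Δ Q φ} → Rule [ quant Q φ ∷ Γ ▷ Δ ] (inst Q φ ∷ Γ ▷ Δ)
    QR↓   : ∀ {Γ Δ Q φ} → Rule [ Γ ▷ inst Q φ ∷ Δ ] (Γ ▷ quant Q φ ∷ Δ)
    QR↑   : ∀ {Γ Δ Q φ} → Rule [ Γ ▷ quant Q φ ∷ Δ ] (Γ ▷ inst Q φ ∷ Δ)
    ∀WitL : ∀ {Γ Δ φ} t → Rule [ φ [x↦ t ] ∷ Γ ▷ Δ ] (inst ∀q φ ∷ Γ ▷ Δ)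
    ∀WitR : ∀ {Γ Δ φ} t → Rule [ Γ ▷ inst ∀q φ ∷ Δ ] (Γ ▷ φ [x↦ t ] ∷ Δ)
    ∃WitR : ∀ {Γ Δ φ} t → Rule [ Γ ▷ φ [x↦ t ] ∷ Δ ] (Γ ▷ inst ∃q φ ∷ Δ)
    ∃WitL : ∀ {Γ Δ φ} t → Rule [ inst ∃q φ ∷ Γ ▷ Δ ] (φ [x↦ t ] ∷ Γ ▷ Δ)

  data Provable : Sequent → Set where
    by : ∀ {ps c} → Rule ps c → All Provable ps → Provable c

  record IsTheory (T : Sequent → Set) : Set where
    field
      provable : ∀ {S} → Provable S → T S
      closed   : ∀ {ps c} → Rule ps c → All T ps → T c

  Theory : Set₁
  Theory = Σ (Sequent → Set) IsTheory

  _∋_ : Theory → Sequent → Set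
  T ∋ S = proj₁ T S

  _≤_ : (Sequent → Set) → (Sequent → Set) → Set
  A ≤ B = ∀ S → A S → B S

  _≐_ : (Sequent → Set) → (Sequent → Set) → Set
  A ≐ B = A ≤ B × B ≤ A

  ⟦_⟧ : Theory → Sequent → Set
  ⟦ T ⟧ = T ∋_

  ⋀ : List Theory → Sequent → Set
  ⋀ [] S      = ⊤
  ⋀ (U ∷ X) S = U ∋ S × ⋀ X S

  Prime : Theory → Set
  Prime T = ∀ Γ Δ → T ∋ (Γ ▷ Δ) → ¬ (Γ ≡ [] × Δ ≡ []) →
            (∃ λ γ → γ ∈ Γ × T ∋ ([ γ ] ▷ []))
            ⊎ (∃ λ δ → δ ∈ Δ × T ∋ ([] ▷ [ δ ]))

  MeetIrreducible : Theory → Set₁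
  MeetIrreducible T = ∀ (X : List Theory) → ¬ X ≡ [] → ⋀ X ≐ ⟦ T ⟧ →
                      Any (λ U → ⟦ U ⟧ ≐ ⟦ T ⟧) X

  MeetPrime : Theory → Set₁
  MeetPrime T = ∀ (X : List Theory) → ¬ X ≡ [] → ⋀ X ≤ ⟦ T ⟧ →
                Any (λ U → ⟦ U ⟧ ≤ ⟦ T ⟧) X

-- Every rule of ST^H acts on the front of a sequent and shares its context, so a
-- derivation stays a derivation when the same sequent E is appended to all of its
-- sequents.  Writing T + A for the theory generated by T and A, this gives
-- (T + A) ∩ (T + B) ⊆ T + (A ⊕ B), where ⊕ concatenates both sides.  If T is
-- meet-irreducible and Γ ▷ Δ ∈ T, then T is the meet of the theories T + (γ ▷)
-- and T + (▷ δ), hence equal to one of them, which is primality.  Conversely, if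
-- T is prime and no theory U in X is below T, choose (classically) S_U ∈ U ∖ T;
-- primality keeps the concatenation of all S_U outside T, while it lies in every U.

module Submission where

open import Defs
open import Level using (0ℓ)
open import Axiom.ExcludedMiddle using (ExcludedMiddle)
open import Axiom.DoubleNegationElimination using (em⇒dne)
open import Data.Product using (_×_; _,_; proj₁; proj₂; ∃; map₂)
open import Data.Sum using (_⊎_; inj₁; inj₂; [_,_]′)
open import Data.Empty using (⊥-elim)
open import Data.Unit using (tt)
open import Function.Base using (_∘_)
open import Function.Bundles using (_⇔_; mk⇔)
open import Data.List using (List; []; _∷_; [_]; _++_; map)
open import Data.List.Relation.Unary.All as All using (All; []; _∷_)
open import Data.List.Relation.Unary.All.Properties using (¬Any⇒All¬; map⁺)
open import Data.List.Relation.Unary.Any using (Any; here; any?)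
open import Data.List.Relation.Unary.Any.Properties using (map⁻; ++⁻)
open import Data.List.Membership.Propositional using (_∈_; find; lose)
open import Data.List.Membership.Propositional.Properties using (∈-++⁻)
open import Data.List.Relation.Binary.Subset.Propositional using (_⊆_)
open import Data.List.Relation.Binary.Subset.Propositional.Properties
  using (⊆-refl; xs⊆xs++ys; xs⊆ys++xs; ++⁺ˡ)
open import Relation.Nullary using (¬_; Dec; yes; no)
open import Relation.Binary.PropositionalEquality using (_≡_; refl; subst₂)

++-lub : {A : Set} {xs ys zs : List A} → xs ⊆ zs → ys ⊆ zs → xs ++ ys ⊆ zs
++-lub {xs = xs} xs⊆zs ys⊆zs x∈ = [ xs⊆zs , ys⊆zs ]′ (∈-++⁻ xs x∈)

module HenkinLattice (𝓛 : Signature) where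
  open Henkin 𝓛

  Closed : (Sequent → Set) → Set
  Closed G = ∀ {ps c} → Rule ps c → All G ps → G c

  theory-closed : (T : Theory) → Closed ⟦ T ⟧
  theory-closed T = IsTheory.closed (proj₂ T)

  infixr 6 _⊕_
  infix 3 _⊑_

  _⊕_ : Sequent → Sequent → Sequent
  (Γ ▷ Δ) ⊕ (Γ' ▷ Δ') = Γ ++ Γ' ▷ Δ ++ Δ'

  _⊑_ : Sequent → Sequent → Set
  (Γ ▷ Δ) ⊑ (Γ' ▷ Δ') = Γ ⊆ Γ' × Δ ⊆ Δ'

  ⊑-refl : ∀ {S} → S ⊑ S
  ⊑-refl = ⊆-refl , ⊆-refl

  ⊑-empty : ∀ {S} → [] ▷ [] ⊑ S
  ⊑-empty = (λ ()) , (λ ())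

  ⊑-⊕ˡ : ∀ S E → S ⊑ S ⊕ E
  ⊑-⊕ˡ (Γ ▷ Δ) (Γ' ▷ Δ') = xs⊆xs++ys Γ Γ' , xs⊆xs++ys Δ Δ'

  ⊑-⊕ʳ : ∀ S E → E ⊑ S ⊕ E
  ⊑-⊕ʳ (Γ ▷ Δ) (Γ' ▷ Δ') = xs⊆ys++xs Γ' Γ , xs⊆ys++xs Δ' Δ

  ⊕-lub : ∀ {S E U} → S ⊑ U → E ⊑ U → S ⊕ E ⊑ U
  ⊕-lub (Γ⊆ , Δ⊆) (Γ'⊆ , Δ'⊆) = ++-lub Γ⊆ Γ'⊆ , ++-lub Δ⊆ Δ'⊆

  weaken : ∀ {G S S'} → Closed G → S ⊑ S' → G S → G S'
  weaken cl (Γ⊆ , Δ⊆) g = cl (Weak Γ⊆ Δ⊆) (g ∷ [])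

  ⊕-closed : ∀ {G} → Closed G → ∀ E → Closed (λ S → G (S ⊕ E))
  ⊕-closed {G} cl E = extended
    where
      shift : ∀ {ps} → All (λ p → G (p ⊕ E)) ps → All G (map (_⊕ E) ps)
      shift = map⁺

      extended : Closed (λ S → G (S ⊕ E))
      extended (Id φ) []           = weaken cl (⊑-⊕ˡ ([ φ ] ▷ [ φ ]) E) (cl (Id φ) [])
      extended (Weak Γ⊆ Δ⊆) (g ∷ []) = weaken cl (++⁺ˡ _ Γ⊆ , ++⁺ˡ _ Δ⊆) g
      extended ∧L↓ gs      = cl ∧L↓ (shift gs)
      extended ∧L↑ gs      = cl ∧L↑ (shift gs)
      extended ∧R↓ gs      = cl ∧R↓ (shift gs)
      extended ∧R↑₁ gs     = cl ∧R↑₁ (shift gs)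
      extended ∧R↑₂ gs     = cl ∧R↑₂ (shift gs)
      extended ∨L↓ gs      = cl ∨L↓ (shift gs)
      extended ∨L↑₁ gs     = cl ∨L↑₁ (shift gs)
      extended ∨L↑₂ gs     = cl ∨L↑₂ (shift gs)
      extended ∨R↓ gs      = cl ∨R↓ (shift gs)
      extended ∨R↑ gs      = cl ∨R↑ (shift gs)
      extended ¬L↓ gs      = cl ¬L↓ (shift gs)
      extended ¬L↑ gs      = cl ¬L↑ (shift gs)
      extended ¬R↓ gs      = cl ¬R↓ (shift gs)
      extended ¬R↑ gs      = cl ¬R↑ (shift gs)
      extended QL↓ gs      = cl QL↓ (shift gs)
      extended QL↑ gs      = cl QL↑ (shift gs)
      extended QR↓ gs      = cl QR↓ (shift gs)
      extended QR↑ gs      = cl QR↑ (shift gs)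
      extended (∀WitL t) gs = cl (∀WitL t) (shift gs)
      extended (∀WitR t) gs = cl (∀WitR t) (shift gs)
      extended (∃WitR t) gs = cl (∃WitR t) (shift gs)
      extended (∃WitL t) gs = cl (∃WitL t) (shift gs)

  ⋀-closed : ∀ X → Closed (⋀ X)
  ⋀-closed []      r gs = tt
  ⋀-closed (U ∷ X) r gs = theory-closed U r (All.map proj₁ gs) , ⋀-closed X r (All.map proj₂ gs)

  ≤-⋀ : ∀ {P} X → All (λ U → P ≤ ⟦ U ⟧) X → P ≤ ⋀ X
  ≤-⋀ []      []             S p = tt
  ≤-⋀ (U ∷ X) (P≤U ∷ P≤X) S p = P≤U S p , ≤-⋀ X P≤X S p

  ≤-⋀⁻ : ∀ {P} X → P ≤ ⋀ X → All (λ U → P ≤ ⟦ U ⟧) X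
  ≤-⋀⁻ []      P≤X = []
  ≤-⋀⁻ (U ∷ X) P≤X = (λ S p → proj₁ (P≤X S p)) ∷ ≤-⋀⁻ X (λ S p → proj₂ (P≤X S p))

  ¬≤⇒witness : ExcludedMiddle 0ℓ → ∀ {P Q} → ¬ (P ≤ Q) → ∃ λ S → P S × ¬ Q S
  ¬≤⇒witness em P≰Q = dne λ noWitness → P≰Q λ S p → dne λ ¬q → noWitness (S , p , ¬q)
    where dne = em⇒dne em

  isEmptySequent? : (Γ Δ : List Formula) → Dec (Γ ≡ [] × Δ ≡ [])
  isEmptySequent? []      []      = yes (refl , refl)
  isEmptySequent? (_ ∷ _) _       = no λ { (() , _) }
  isEmptySequent? []      (_ ∷ _) = no λ { (_ , ()) }

  ⊑-antecedent : ∀ {γ Γ Δ} → γ ∈ Γ → [ γ ] ▷ [] ⊑ Γ ▷ Δ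
  ⊑-antecedent γ∈Γ = (λ { (here refl) → γ∈Γ }) , (λ ())

  ⊑-succedent : ∀ {δ Γ Δ} → δ ∈ Δ → [] ▷ [ δ ] ⊑ Γ ▷ Δ
  ⊑-succedent δ∈Δ = (λ ()) , (λ { (here refl) → δ∈Δ })

  module _ (T : Theory) where

    T-weaken : ∀ {S S'} → S ⊑ S' → T ∋ S → T ∋ S'
    T-weaken = weaken (theory-closed T)

    prime-∉-⊕ : Prime T → ∀ {S S'} → ¬ T ∋ S → ¬ T ∋ S' → ¬ T ∋ (S ⊕ S')
    prime-∉-⊕ prime {Γ ▷ Δ} {Γ' ▷ Δ'} S∉T S'∉T S⊕S'∈T
      with isEmptySequent? (Γ ++ Γ') (Δ ++ Δ')
    ... | yes (Γ≡ , Δ≡) =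
      S∉T (T-weaken ⊑-empty (subst₂ (λ Γ Δ → T ∋ (Γ ▷ Δ)) Γ≡ Δ≡ S⊕S'∈T))
    ... | no nonEmpty with prime (Γ ++ Γ') (Δ ++ Δ') S⊕S'∈T nonEmpty
    ...   | inj₁ (γ , γ∈ , γ∈T) =
      [ (λ γ∈Γ → S∉T (T-weaken (⊑-antecedent γ∈Γ) γ∈T))
      , (λ γ∈Γ' → S'∉T (T-weaken (⊑-antecedent γ∈Γ') γ∈T)) ]′ (∈-++⁻ Γ γ∈)
    ...   | inj₂ (δ , δ∈ , δ∈T) =
      [ (λ δ∈Δ → S∉T (T-weaken (⊑-succedent δ∈Δ) δ∈T))
      , (λ δ∈Δ' → S'∉T (T-weaken (⊑-succedent δ∈Δ') δ∈T)) ]′ (∈-++⁻ Δ δ∈)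

    -- A ⊢ S says S ∈ T + A: S is derivable by the rules from T together with A.
    infix 3 _⊢_

    data _⊢_ (A : Sequent) : Sequent → Set where
      axiom      : ∀ {S} → T ∋ S → A ⊢ S
      assumption : A ⊢ A
      rule       : ∀ {ps c} → Rule ps c → All (A ⊢_) ps → A ⊢ c

    extend : Sequent → Theory
    extend A = (A ⊢_) , record { provable = axiom ∘ IsTheory.provable (proj₂ T) ; closed = rule }

    module _ {A : Sequent} {G : Sequent → Set} (G-closed : Closed G) (T≤G : ⟦ T ⟧ ≤ G) (A∈G : G A) where
      mutual
        ⊢-least : ∀ {S} → A ⊢ S → G S
        ⊢-least (axiom S∈T) = T≤G _ S∈T
        ⊢-least assumption  = A∈G
        ⊢-least (rule r ds) = G-closed r (⊢-least-All ds)

        ⊢-least-All : ∀ {ps} → All (A ⊢_) ps → All G ps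
        ⊢-least-All []       = []
        ⊢-least-All (d ∷ ds) = ⊢-least d ∷ ⊢-least-All ds

    ⊢-weaken : ∀ {A S S'} → S ⊑ S' → A ⊢ S → A ⊢ S'
    ⊢-weaken = weaken rule

    ⊢-append : ∀ {A B X} → B ⊢ X → A ⊕ B ⊢ X ⊕ A
    ⊢-append {A} {B} = ⊢-least {B} (⊕-closed rule A)
      (λ S S∈T → axiom (T-weaken (⊑-⊕ˡ S A) S∈T))
      (⊢-weaken (⊕-lub (⊑-⊕ʳ B A) (⊑-⊕ˡ B A)) assumption)

    -- The extra context C is what lets the induction pass through rules: the
    -- premises p of a rule with conclusion c are handled with context c ⊕ C.
    ⊢-⊕-context : ∀ {A B S} → A ⊢ S → ∀ C → B ⊢ S ⊕ C → A ⊕ B ⊢ S ⊕ C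
    ⊢-⊕-context {A} {B} = ⊢-least P-closed
      (λ S S∈T C _ → axiom (T-weaken (⊑-⊕ˡ S C) S∈T))
      (λ C d → ⊢-weaken (⊕-lub ⊑-refl (⊑-⊕ˡ A C)) (⊢-append d))
      where
        P : Sequent → Set
        P S = ∀ C → B ⊢ S ⊕ C → A ⊕ B ⊢ S ⊕ C

        P-closed : Closed P
        P-closed {c = c} r Ps C d =
          ⊢-weaken (⊕-lub (⊑-⊕ˡ c C) ⊑-refl)
            (⊕-closed rule (c ⊕ C) r (All.map (λ {p} Pp → Pp (c ⊕ C) (⊢-weaken (⊑-⊕ʳ p (c ⊕ C)) d)) Ps))

    ⊢-⊕ : ∀ {A B S} → A ⊢ S → B ⊢ S → A ⊕ B ⊢ S
    ⊢-⊕ {S = S} dA dB = ⊢-weaken (⊕-lub ⊑-refl ⊑-empty) (⊢-⊕-context dA ([] ▷ []) (⊢-weaken (⊑-⊕ˡ S _) dB))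

    ⊢-∈ : ∀ {A S} → T ∋ A → A ⊢ S → T ∋ S
    ⊢-∈ A∈T = ⊢-least (theory-closed T) (λ _ S∈T → S∈T) A∈T

    atoms : List Formula → List Formula → List Sequent
    atoms Γ Δ = map (λ γ → [ γ ] ▷ []) Γ ++ map (λ δ → [] ▷ [ δ ]) Δ

    extensions : List Formula → List Formula → List Theory
    extensions Γ Δ = map extend (atoms Γ Δ)

    extensions≢[] : ∀ Γ Δ → ¬ (Γ ≡ [] × Δ ≡ []) → ¬ extensions Γ Δ ≡ []
    extensions≢[] []      []      nonEmpty _  = nonEmpty (refl , refl)
    extensions≢[] (_ ∷ _) _       nonEmpty ()
    extensions≢[] []      (_ ∷ _) nonEmpty ()

    ⋀-extensions : ∀ Γ Δ → ⋀ (extensions Γ Δ) ≤ (Γ ▷ Δ ⊢_)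
    ⋀-extensions []      []      S _        = ⊢-weaken ⊑-empty assumption
    ⋀-extensions (γ ∷ Γ) Δ       S (d , ds) = ⊢-⊕ d (⋀-extensions Γ Δ S ds)
    ⋀-extensions []      (δ ∷ Δ) S (d , ds) = ⊢-⊕ d (⋀-extensions [] Δ S ds)

    ⋀-extensions≐ : ∀ {Γ Δ} → T ∋ (Γ ▷ Δ) → ⋀ (extensions Γ Δ) ≐ ⟦ T ⟧
    ⋀-extensions≐ {Γ} {Δ} Γ▷Δ∈T =
        (λ S d → ⊢-∈ Γ▷Δ∈T (⋀-extensions Γ Δ S d))
      , ≤-⋀ _ (map⁺ (All.universal (λ _ _ → axiom) (atoms Γ Δ)))

    extend≤⇒∈ : ∀ {A} → ⟦ extend A ⟧ ≤ ⟦ T ⟧ → T ∋ A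
    extend≤⇒∈ extendA≤T = extendA≤T _ assumption

    meetIrreducible⇒prime : MeetIrreducible T → Prime T
    meetIrreducible⇒prime irreducible Γ Δ Γ▷Δ∈T nonEmpty
      with ++⁻ (map _ Γ) (map⁻ (irreducible _ (extensions≢[] Γ Δ nonEmpty) (⋀-extensions≐ Γ▷Δ∈T)))
    ... | inj₁ γ-atom = inj₁ (map₂ (map₂ (extend≤⇒∈ ∘ proj₁)) (find (map⁻ γ-atom)))
    ... | inj₂ δ-atom = inj₂ (map₂ (map₂ (extend≤⇒∈ ∘ proj₁)) (find (map⁻ δ-atom)))

    commonOutsider : Prime T → ∀ U X → All (λ V → ∃ λ S → V ∋ S × ¬ T ∋ S) (U ∷ X) →
                     ∃ λ S → ⋀ (U ∷ X) S × ¬ T ∋ S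
    commonOutsider prime U []      ((S , S∈U , S∉T) ∷ []) = S , (S∈U , tt) , S∉T
    commonOutsider prime U (V ∷ X) ((S , S∈U , S∉T) ∷ outsiders) =
      let S' , S'∈⋀X , S'∉T = commonOutsider prime V X outsiders
      in  S ⊕ S'
        , (weaken (theory-closed U) (⊑-⊕ˡ S S') S∈U , weaken (⋀-closed (V ∷ X)) (⊑-⊕ʳ S S') S'∈⋀X)
        , prime-∉-⊕ prime S∉T S'∉T

    prime⇒meetPrime : ExcludedMiddle 0ℓ → Prime T → MeetPrime T
    prime⇒meetPrime em prime []      X≢[] ⋀X≤T = ⊥-elim (X≢[] refl)
    prime⇒meetPrime em prime (U ∷ X) _    ⋀X≤T with any? (λ V → em {⟦ V ⟧ ≤ ⟦ T ⟧}) (U ∷ X)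
    ... | yes someBelow = someBelow
    ... | no noneBelow =
      let S , S∈⋀X , S∉T = commonOutsider prime U X (All.map (¬≤⇒witness em) (¬Any⇒All¬ _ noneBelow))
      in ⊥-elim (S∉T (⋀X≤T S S∈⋀X))

    meetPrime⇒meetIrreducible : MeetPrime T → MeetIrreducible T
    meetPrime⇒meetIrreducible meetPrime X X≢[] (⋀X≤T , T≤⋀X) =
      let U , U∈X , U≤T = find (meetPrime X X≢[] ⋀X≤T)
      in  lose U∈X (U≤T , All.lookup (≤-⋀⁻ X T≤⋀X) U∈X)

mainTheorem10 : ExcludedMiddle 0ℓ → (𝓛 : Signature) → (T : Henkin.Theory 𝓛) →
    (Henkin.Prime 𝓛 T ⇔ Henkin.MeetPrime 𝓛 T) × (Henkin.Prime 𝓛 T ⇔ Henkin.MeetIrreducible 𝓛 T)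
mainTheorem10 em 𝓛 T =
    mk⇔ (prime⇒meetPrime T em) (meetIrreducible⇒prime T ∘ meetPrime⇒meetIrreducible T)
  , mk⇔ (meetPrime⇒meetIrreducible T ∘ prime⇒meetPrime T em) (meetIrreducible⇒prime T)
  where open HenkinLattice 𝓛
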